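{- Let $Q$ be an IPC formula and $\theta = (Z_N, \dots, Z_0)$ a finite sequence of IPC formulas, each of the form $QW$ or $QQW$ for some IPC formula $W$. Suppose some term of $\theta$ is a formula $\alpha = Q(X \supset Y)$ for IPC formulas $X, Y$, and put $\alpha_0 = QQX$, $\alpha_1 = QY$. If $\mathcal{D}(\alpha_0, \theta)$ is a theorem of IPC or $\mathcal{D}(\alpha_1, \theta)$ is a theorem of IPC, then $\mathcal{D}(\theta)$ is a theorem of IPC.
   Context: The Implicational Propositional Calculus (IPC) has formulas built from propositional variables using only $\supset$, the single inference rule modus ponens, and the axiom schemes $X \supset (Y \supset X)$, $[X \supset (Y \supset Z)] \supset [(X \supset Y) \supset (X \supset Z)]$ and $[(X \supset Y) \supset X] \supset X$. For an IPC formula $Z$ write $QZ := Z \supset Q$. For a sequence $\theta = (Z_N, \dots, Z_0)$ of IPC formulas, $\mathcal{D}(\theta) := Z_N \supset (Z_{N-1} \supset ( \cdots (Z_0 \supset Q) \cdots ))$, and for a formula $W$, $(W,\theta)$ denotes the sequence $(W, Z_N, \dots, Z_0)$, so $\mathcal{D}(W,\theta) = W \supset \mathcal{D}(\theta)$. -}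

module Defs where

open import Data.Nat using (ℕ)
open import Data.List using (List; []; _∷_; foldr)
open import Data.Product using (Σ; _×_)
open import Data.Sum using (_⊎_)
open import Relation.Binary.PropositionalEquality using (_≡_)

infixr 5 _⊃_

data Formula : Set where
  var : ℕ → Formula
  _⊃_ : Formula → Formula → Formula

data ⊢_ : Formula → Set where
  ax1 : ∀ X Y → ⊢ (X ⊃ (Y ⊃ X))
  ax2 : ∀ X Y Z → ⊢ ((X ⊃ (Y ⊃ Z)) ⊃ ((X ⊃ Y) ⊃ (X ⊃ Z)))
  ax3 : ∀ X Y → ⊢ (((X ⊃ Y) ⊃ X) ⊃ X)
  mp  : ∀ {X Y} → ⊢ (X ⊃ Y) → ⊢ X → ⊢ Y

_⟪_⟫ : Formula → Formula → Formula
Q ⟪ Z ⟫ = Z ⊃ Q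

-- A sequence θ = (Z_N, …, Z_0) is the list Z_N ∷ … ∷ Z_0 ∷ [];
-- 𝒟 θ = Z_N ⊃ (… ⊃ (Z_0 ⊃ Q)); (W, θ) is W ∷ θ.
𝒟 : Formula → List Formula → Formula
𝒟 Q θ = foldr _⊃_ Q θ

QForm : Formula → Formula → Set
QForm Q Z = Σ Formula (λ W → (Z ≡ Q ⟪ W ⟫) ⊎ (Z ≡ Q ⟪ Q ⟪ W ⟫ ⟫))

-- The argument works with derivations from hypotheses, Γ ⊩ A.
-- Next come the two IPC theorems α ⊃ α₁ (intuitionistic) and α ⊃ α₀
-- (needing Peirce's law).  So each αᵢ is derivable from θ ∋ α, and a cut
-- lemma finishes: if ⊢ 𝒟(W, θ) and θ ⊩ W, then θ ⊩ Q, hence ⊢ 𝒟(θ).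
module Submission where

open import Defs
open import Data.List using (List; []; _∷_; _++_)
open import Data.List.Relation.Unary.All using (All)
open import Data.List.Relation.Unary.Any using (here; there)
open import Data.List.Membership.Propositional using (_∈_)
open import Data.List.Relation.Binary.Subset.Propositional using (_⊆_)
open import Data.List.Relation.Binary.Subset.Propositional.Properties
  using (⊆-refl; ⊆-reflexive-↭; xs⊆xs++ys)
open import Data.List.Relation.Binary.Permutation.Propositional using (↭-sym)
open import Data.List.Relation.Binary.Permutation.Propositional.Properties using (shift)
open import Data.Sum using (_⊎_; inj₁; inj₂)
open import Relation.Binary.PropositionalEquality using (refl)

infix 4 _⊩_

data _⊩_ (Γ : List Formula) : Formula → Set where
  hyp : ∀ {A} → A ∈ Γ → Γ ⊩ A
  thm : ∀ {A} → ⊢ A → Γ ⊩ A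
  app : ∀ {A B} → Γ ⊩ A ⊃ B → Γ ⊩ A → Γ ⊩ B

weaken : ∀ {Γ Δ A} → Γ ⊆ Δ → Γ ⊩ A → Δ ⊩ A
weaken Γ⊆Δ (hyp A∈Γ) = hyp (Γ⊆Δ A∈Γ)
weaken Γ⊆Δ (thm ⊢A)  = thm ⊢A
weaken Γ⊆Δ (app f x) = app (weaken Γ⊆Δ f) (weaken Γ⊆Δ x)

identity : ∀ A → ⊢ (A ⊃ A)
identity A = mp (mp (ax2 A (A ⊃ A) A) (ax1 A (A ⊃ A))) (ax1 A A)

deduction : ∀ {Γ A B} → A ∷ Γ ⊩ B → Γ ⊩ A ⊃ B
deduction {A = A}     (hyp (here refl)) = thm (identity A)
deduction {A = A} {B} (hyp (there B∈Γ)) = app (thm (ax1 B A)) (hyp B∈Γ)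
deduction {A = A} {B} (thm ⊢B)          = thm (mp (ax1 B A) ⊢B)
deduction {A = A} {B} (app {C} f x)     =
  app (app (thm (ax2 A C B)) (deduction f)) (deduction x)

closed : ∀ {A} → [] ⊩ A → ⊢ A
closed (hyp ())
closed (thm ⊢A)  = ⊢A
closed (app f x) = mp (closed f) (closed x)

discharge : ∀ θ {Γ A} → θ ++ Γ ⊩ A → Γ ⊩ 𝒟 A θ
discharge []      h = h
discharge (Z ∷ θ) {Γ} h =
  deduction (discharge θ (weaken (⊆-reflexive-↭ (↭-sym (shift Z θ Γ))) h))

apply-all : ∀ θ {Γ A} → θ ⊆ Γ → Γ ⊩ 𝒟 A θ → Γ ⊩ A
apply-all []      θ⊆Γ h = h
apply-all (Z ∷ θ) θ⊆Γ h =
  apply-all θ (λ Z'∈θ → θ⊆Γ (there Z'∈θ)) (app h (hyp (θ⊆Γ (here refl))))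

cut : ∀ A θ {W} → ⊢ 𝒟 A (W ∷ θ) → θ ⊩ W → ⊢ 𝒟 A θ
cut A θ ⊢𝒟Wθ θ⊩W =
  closed (discharge θ (weaken (xs⊆xs++ys θ [])
    (apply-all θ ⊆-refl (app (thm ⊢𝒟Wθ) θ⊩W))))

-- α ⊃ α₁:  Q(X ⊃ Y) ⊃ QY, since Y implies X ⊃ Y.
α⇒α₁ : ∀ Q X Y → ⊢ (Q ⟪ X ⊃ Y ⟫ ⊃ Q ⟪ Y ⟫)
α⇒α₁ Q X Y = closed (deduction (deduction
  (app (hyp (there (here refl)))         -- α
       (app (thm (ax1 Y X)) (hyp (here refl))))))

-- α ⊃ α₀:  Q(X ⊃ Y) ⊃ QQX.  Assuming α and QX, Peirce's law
-- ((Q ⊃ Y) ⊃ Q) ⊃ Q reduces Q to showing α's premise X ⊃ Y under Q ⊃ Y,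
-- which holds since X gives Q by QX and then Y.
α⇒α₀ : ∀ Q X Y → ⊢ (Q ⟪ X ⊃ Y ⟫ ⊃ Q ⟪ Q ⟪ X ⟫ ⟫)
α⇒α₀ Q X Y = closed (deduction (deduction
  (app (thm (ax3 Q Y))
    (deduction                                      -- assume Q ⊃ Y
      (app (hyp (there (there (here refl))))        -- α
        (deduction                                  -- assume X
          (app (hyp (there (here refl)))            -- Q ⊃ Y
            (app (hyp (there (there (here refl))))  -- QX
                 (hyp (here refl))))))))))          -- X

theorem8 : (Q : Formula) (θ : List Formula) → All (QForm Q) θ →
    (X Y : Formula) → (Q ⟪ X ⊃ Y ⟫) ∈ θ →
    (⊢ 𝒟 Q (Q ⟪ Q ⟪ X ⟫ ⟫ ∷ θ)) ⊎ (⊢ 𝒟 Q (Q ⟪ Y ⟫ ∷ θ)) →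
    ⊢ 𝒟 Q θ
theorem8 Q θ _ X Y α∈θ (inj₁ ⊢𝒟α₀θ) =
  cut Q θ ⊢𝒟α₀θ (app (thm (α⇒α₀ Q X Y)) (hyp α∈θ))
theorem8 Q θ _ X Y α∈θ (inj₂ ⊢𝒟α₁θ) =
  cut Q θ ⊢𝒟α₁θ (app (thm (α⇒α₁ Q X Y)) (hyp α∈θ))
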